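{- Let $L$ be a nonnegative integer, and suppose the following statement holds: for all nonnegative integers $a,x,y,m,n,l$ with $a<L$, $a = x+2^{mn}y$, $n$ a power of $2$, $y<2^n$, $2^{(m+1)n}\mid x$, the period length of $x+1$ in $B_\infty$ equal to $2^l$, and $l\le n$, we have that $\langle a\rangle$ is isomorphic to $\langle 2^{l+n}-2^n+y\rangle$ and, for every $i$, if $(2^{l+n}-2^n+y+1)\backslash i = 2^nw+y'$ with $y'<2^n$, then $(a+1)\backslash i = ((x+1)\backslash w)+2^{mn}y'$. Let $x,s,l$ be nonnegative integers with $x+2^s-1<L$, $2^s\mid x$, the period length of $x+1$ equal to $2^l$, and $l$ less than or equal to some power of $2$ dividing $s$. Then $(x+2^s)\backslash(2^s i+i') = ((x+1)\backslash i)+i'$ for all $i\ge0$ and all $0\le i'<2^s$ (so the period length of $x+2^s$ is $2^{l+s}$).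
   Context: For $n\ge0$, $B_n$ is the set $\{0,1,\dots,2^n-1\}$ with the binary operation $\backslash$ defined recursively by: $0\backslash x = x$; $x\backslash(2^n-1) = x-1$ for $x>0$; $x\backslash(y-1) = (x\backslash y)\backslash(x-1)$ for $x,y>0$. This is a well-defined left-distributive operation, and $B_n$ is a subalgebra of $B_N$ for $N\ge n$; $B_\infty$ is the union of all $B_n$ with operation $\backslash$ (on the nonnegative integers). For $x>0$ the sequence $x\backslash 0, x\backslash 1,\dots$ is periodic; its period length is the least positive $p$ with $x\backslash p = 0$, and it is a power of $2$. $\langle x\rangle$ denotes the subalgebra of $B_\infty$ generated by $x$. -}

module Defs where

open import Data.Nat using (ℕ; zero; suc; _+_; _*_; _∸_; _^_; _≤_; _<_)
open import Data.Nat.Divisibility using (_∣_)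
open import Data.Product using (_×_; ∃)
open import Relation.Binary.PropositionalEquality using (_≡_; _≢_)

-- The operation of B_n, computed with fuel.
-- laverB n k x y = x \ y in B_n, provided x ≤ k and x, y < 2^n.
-- For x = suc x', the row of x is computed downward from y = 2^n - 1:
-- with d = 2^n - 1 - y,  d = 0 gives x \ (2^n-1) = x - 1, and
-- x \ (y-1) = (x \ y) \ (x-1).  The recursive call uses fuel k for the
-- element x \ y, which is < x (a standard fact on B_n), so it is ≤ k.
laverB : ℕ → ℕ → ℕ → ℕ → ℕ
laverB n zero    x       y = y
laverB n (suc k) zero    y = y
laverB n (suc k) (suc x) y = row (2 ^ n ∸ 1 ∸ y)
  where
  row : ℕ → ℕ
  row zero    = x
  row (suc d) = laverB n k (row d) x

-- The operation of B_∞: compute in B_N with N = x + y + 1 (so x, y < 2^N).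
infixl 7 _⧵_
_⧵_ : ℕ → ℕ → ℕ
x ⧵ y = laverB (x + y + 1) x x y

PeriodLength : ℕ → ℕ → Set
PeriodLength x p = (0 < p) × (x ⧵ p ≡ 0) × (∀ q → 0 < q → q < p → x ⧵ q ≢ 0)

IsPow2 : ℕ → Set
IsPow2 n = ∃ λ k → n ≡ 2 ^ k

data ⟨_⟩ (a : ℕ) : ℕ → Set where
  gen  : ⟨ a ⟩ a
  op   : ∀ {u v} → ⟨ a ⟩ u → ⟨ a ⟩ v → ⟨ a ⟩ (u ⧵ v)

record _≅_ (a b : ℕ) : Set where
  field
    to      : ℕ → ℕ
    from    : ℕ → ℕ
    to-mem  : ∀ u → ⟨ a ⟩ u → ⟨ b ⟩ (to u)
    from-mem : ∀ v → ⟨ b ⟩ v → ⟨ a ⟩ (from v)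
    from-to : ∀ u → ⟨ a ⟩ u → from (to u) ≡ u
    to-from : ∀ v → ⟨ b ⟩ v → to (from v) ≡ v
    hom     : ∀ u v → ⟨ a ⟩ u → ⟨ a ⟩ v → to (u ⧵ v) ≡ to u ⧵ to v

Hyp : ℕ → Set
Hyp L = ∀ a x y m n l → a < L → a ≡ x + 2 ^ (m * n) * y → IsPow2 n → y < 2 ^ n
      → 2 ^ ((m + 1) * n) ∣ x → PeriodLength (x + 1) (2 ^ l) → l ≤ n
      → (a ≅ (2 ^ (l + n) ∸ 2 ^ n + y))
        × (∀ i w y' → y' < 2 ^ n → (2 ^ (l + n) ∸ 2 ^ n + y + 1) ⧵ i ≡ 2 ^ n * w + y'
           → (a + 1) ⧵ i ≡ (x + 1) ⧵ w + 2 ^ (m * n) * y')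

-- Rows of B_∞ are orbits read backwards: if v ↦ v ⧵ x, started at 0, is back at 0 after
-- b + j steps, then (x + 1) ⧵ b is its j-th point. For x < 2^n the orbit computed in B_n
-- returns at step 2^n; this periodicity is proved by induction on n, using that reduction
-- mod 2^n is a homomorphism B_(n+1) → B_n, and it also makes B_n a subalgebra of B_(n+1).
-- Consequently the row of 2^N is reduction mod 2^N, and a row is periodic with its period.
--
-- For the lemma, write s as a sum of distinct powers of two, each a multiple of 2^k, and
-- remove them from the largest down. If t has been removed and N is the next power, the
-- hypothesis with m N = t and y = 2^N − 1 describes the row of x + 2^s − 2^t + 1 through
-- the row of x + 2^s − 2^(t+N) + 1. The latter has period 2^(l+d) with d = s − t − N, and
-- l + d ≤ N because l ≤ 2^k and d is a multiple of 2^k below N. Composing these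
-- descriptions expresses the row of x + 2^s through the row of x + 1.

{-# OPTIONS --safe #-}
module Submission where

open import Defs
open import Data.Nat using (ℕ; _+_; _*_; _∸_; _^_; _≤_; _<_)
open import Data.Nat.Divisibility using (_∣_)
open import Data.Product using (_×_; ∃)
open import Relation.Binary.PropositionalEquality using (_≡_)

open import Data.Nat
  using (zero; suc; pred; _≤?_; _≟_; _%_; _/_; _⊔_; NonZero; ≢-nonZero⁻¹; >-nonZero; >-nonZero⁻¹; z≤n; s≤s; s≤s⁻¹; z<s)
open import Data.Nat.Properties
open import Data.Nat.DivMod
open import Data.Nat.Divisibility
  using (divides; _∣0; ∣-trans; ∣-refl; ∣⇒≤; n∣m*n; ∣m∣n⇒∣m+n; ∣m+n∣m⇒∣n; m%n≡0⇒n∣m; *-monoʳ-∣)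
open import Data.Nat.GeneralisedArithmetic using (fold; fold-+)
open import Data.Nat.Induction using (<-rec)
open import Data.Nat.Tactic.RingSolver using (solve-∀)
open import Data.Product using (_,_; proj₁; proj₂; ∃₂)
open import Data.Sum using (_⊎_; inj₁; inj₂)
open import Function using (id; case_of_)
open import Relation.Nullary using (yes; no; contradiction)
open import Relation.Binary.PropositionalEquality
  using (_≢_; refl; sym; trans; cong; cong₂; subst; subst₂; module ≡-Reasoning)

fold-≤ : ∀ {g : ℕ → ℕ} {c} → (∀ v → v ≤ c → g v ≤ c) → ∀ {z} → z ≤ c → ∀ j → fold z g j ≤ c
fold-≤ g≤ z≤ zero    = z≤
fold-≤ g≤ z≤ (suc j) = g≤ _ (fold-≤ g≤ z≤ j)

fold-map : ∀ {g h π : ℕ → ℕ} {c} → (∀ v → v ≤ c → g v ≤ c) → (∀ v → v ≤ c → π (g v) ≡ h (π v))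
         → ∀ {z} → z ≤ c → ∀ j → π (fold z g j) ≡ fold (π z) h j
fold-map         g≤ π∘g z≤ zero    = refl
fold-map {h = h} g≤ π∘g z≤ (suc j) =
  trans (π∘g _ (fold-≤ g≤ z≤ j)) (cong h (fold-map g≤ π∘g z≤ j))

fold-cong-≤ : ∀ {g h : ℕ → ℕ} {c} → (∀ v → v ≤ c → g v ≤ c) → (∀ v → v ≤ c → g v ≡ h v)
            → ∀ {z} → z ≤ c → ∀ j → fold z g j ≡ fold z h j
fold-cong-≤ = fold-map {π = id}

fold-unique : ∀ {g : ℕ → ℕ} (r : ℕ → ℕ) → (∀ d → r (suc d) ≡ g (r d)) → ∀ d → r d ≡ fold (r 0) g d
fold-unique         r step zero    = refl
fold-unique {g = g} r step (suc d) = trans (step d) (cong g (fold-unique r step d))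

fold-suc : ∀ (g : ℕ → ℕ) z d → fold (g z) g d ≡ fold z g (suc d)
fold-suc g z zero    = refl
fold-suc g z (suc d) = cong g (fold-suc g z d)

fold-descends : ∀ {g : ℕ → ℕ} → (∀ v → g (suc v) ≤ v)
              → ∀ {z} k → (∀ i → i < k → fold z g i ≢ 0) → fold z g k + k ≤ z
fold-descends         dec zero    nz = ≤-reflexive (+-identityʳ _)
fold-descends {g = g} dec {z} (suc k) nz with fold z g k in eq
... | zero  = contradiction eq (nz k ≤-refl)
... | suc w = begin
  g (suc w) + suc k ≤⟨ +-monoˡ-≤ (suc k) (dec w) ⟩
  w + suc k         ≡⟨ +-suc w k ⟩
  suc w + k         ≡⟨ cong (_+ k) eq ⟨
  fold z g k + k    ≤⟨ fold-descends dec k (λ i i<k → nz i (m<n⇒m<1+n i<k)) ⟩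
  z                 ∎
  where open ≤-Reasoning

orbit : (ℕ → ℕ) → ℕ → ℕ
orbit g = fold 0 g

orbit-+ : ∀ g {a} → orbit g a ≡ 0 → ∀ j → orbit g (j + a) ≡ orbit g j
orbit-+ g {a} ga≡0 j = trans (fold-+ 0 g j) (cong (λ z → fold z g j) ga≡0)

orbit-* : ∀ g {a} → orbit g a ≡ 0 → ∀ q → orbit g (q * a) ≡ 0
orbit-* g ga≡0 zero        = refl
orbit-* g {a} ga≡0 (suc q) = trans (orbit-+ g (orbit-* g ga≡0 q) a) ga≡0

orbit-∣ : ∀ g {a j} → orbit g a ≡ 0 → a ∣ j → orbit g j ≡ 0
orbit-∣ g ga≡0 (divides q refl) = orbit-* g ga≡0 q

FirstZero : (ℕ → ℕ) → ℕ → Set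
FirstZero f p = 0 < p × f p ≡ 0 × (∀ q → 0 < q → q < p → f q ≢ 0)

first-zero-≤ : ∀ f n → (∀ q → 0 < q → q ≤ n → f q ≢ 0) ⊎ ∃ (FirstZero f)
first-zero-≤ f zero = inj₁ λ q 0<q q≤0 → contradiction q≤0 (<⇒≱ 0<q)
first-zero-≤ f (suc n) with first-zero-≤ f n | f (suc n) ≟ 0
... | inj₂ found | _      = inj₂ found
... | inj₁ none  | yes fz = inj₂ (suc n , z<s , fz , λ q 0<q q<n → none q 0<q (s≤s⁻¹ q<n))
... | inj₁ none  | no fnz = inj₁ λ q 0<q q≤n → case (m≤n⇒m<n∨m≡n q≤n) of λ
  { (inj₁ q<n)  → none q 0<q (s≤s⁻¹ q<n)
  ; (inj₂ refl) → fnz }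

first-zero : ∀ f {M} → 0 < M → f M ≡ 0 → ∃ (FirstZero f)
first-zero f {M} 0<M fM≡0 with first-zero-≤ f M
... | inj₁ none  = contradiction fM≡0 (none M 0<M ≤-refl)
... | inj₂ found = found

FirstZero-∣ : ∀ {g p} → FirstZero (orbit g) p → ∀ {j} → orbit g j ≡ 0 → p ∣ j
FirstZero-∣ {g} {p} (0<p , gp≡0 , minimal) {j} gj≡0 = m%n≡0⇒n∣m j p j%p≡0
  where
  instance _ = >-nonZero 0<p
  g[j%p]≡0 : orbit g (j % p) ≡ 0
  g[j%p]≡0 = begin
    orbit g (j % p)             ≡⟨ orbit-+ g (orbit-* g gp≡0 (j / p)) (j % p) ⟨
    orbit g (j % p + j / p * p) ≡⟨ cong (orbit g) (m≡m%n+[m/n]*n j p) ⟨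
    orbit g j                   ≡⟨ gj≡0 ⟩
    0                           ∎
    where open ≡-Reasoning
  j%p≡0 : j % p ≡ 0
  j%p≡0 = n≤0⇒n≡0 (≮⇒≥ λ 0<j%p → minimal (j % p) 0<j%p (m%n<n j p) g[j%p]≡0)

0%n≡0 : ∀ n .{{_ : NonZero n}} → 0 % n ≡ 0
0%n≡0 n = m<n⇒m%n≡m (>-nonZero⁻¹ n)

m<2n∧m%n≡0⇒m≡0∨m≡n : ∀ {m n} .{{_ : NonZero n}} → m < 2 * n → m % n ≡ 0 → m ≡ 0 ⊎ m ≡ n
m<2n∧m%n≡0⇒m≡0∨m≡n {m} {n} m<2n m%n≡0
  with m / n | m/n*n≡m (m%n≡0⇒n∣m m n m%n≡0) | m<n*o⇒m/o<n {m} {2} {n} m<2n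
... | 0           | 0≡m   | _ = inj₁ (sym 0≡m)
... | 1           | n+0≡m | _ = inj₂ (trans (sym n+0≡m) (+-identityʳ n))
... | suc (suc _) | _     | s≤s (s≤s ())

-- The first return π of the h-orbit lifts to 0 or to M. In the second case the g-orbit is
-- nonzero from π up to 2π and descends strictly, so it is below M, hence 0, at 2π.
orbit-lift : ∀ {g h : ℕ → ℕ} M .{{_ : NonZero M}} → (∀ v → g (suc v) ≤ v) → (∀ j → orbit g j < 2 * M)
           → (∀ j → orbit g j % M ≡ orbit h j) → orbit h M ≡ 0 → orbit g (2 * M) ≡ 0
orbit-lift {g} {h} M decreasing bounded projects hM≡0
  with first-zero (orbit h) (>-nonZero⁻¹ M) hM≡0
... | π , first@(0<π , hπ≡0 , minimal)
  with m<2n∧m%n≡0⇒m≡0∨m≡n (bounded π) (trans (projects π) hπ≡0)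
...   | inj₁ gπ≡0 = orbit-∣ g {π} gπ≡0 (∣-trans {j = M} (FirstZero-∣ first hM≡0) (n∣m*n 2))
...   | inj₂ gπ≡M = orbit-∣ g {2 * π} g[2π]≡0 (*-monoʳ-∣ {π} {M} 2 (FirstZero-∣ first hM≡0))
  where
  shifted : ∀ i → orbit g (i + π) ≡ fold M g i
  shifted i = trans (fold-+ 0 g i) (cong (λ z → fold z g i) gπ≡M)
  nonzero : ∀ i → i < π → fold M g i ≢ 0
  nonzero zero    _   = ≢-nonZero⁻¹ M
  nonzero (suc i) i<π gi≡0 = minimal (suc i) z<s i<π (begin
    orbit h (suc i)           ≡⟨ orbit-+ h hπ≡0 (suc i) ⟨
    orbit h (suc i + π)       ≡⟨ projects (suc i + π) ⟨
    orbit g (suc i + π) % M   ≡⟨ cong (_% M) (trans (shifted (suc i)) gi≡0) ⟩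
    0 % M                     ≡⟨ 0%n≡0 M ⟩
    0                         ∎)
    where open ≡-Reasoning
  g[2π]<M : orbit g (2 * π) < M
  g[2π]<M = begin-strict
    orbit g (2 * π)     ≡⟨ cong (λ k → orbit g (π + k)) (+-identityʳ π) ⟩
    orbit g (π + π)     ≡⟨ shifted π ⟩
    fold M g π          <⟨ m<m+n _ 0<π ⟩
    fold M g π + π      ≤⟨ fold-descends decreasing π nonzero ⟩
    M                   ∎
    where open ≤-Reasoning
  g[2π]≡0 : orbit g (2 * π) ≡ 0
  g[2π]≡0 = begin
    orbit g (2 * π)     ≡⟨ m<n⇒m%n≡m g[2π]<M ⟨
    orbit g (2 * π) % M ≡⟨ projects (2 * π) ⟩
    orbit h (2 * π)     ≡⟨ orbit-* h {π} hπ≡0 2 ⟩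
    0                   ∎
    where open ≡-Reasoning

suc[m∸1∸n]≡m∸n : ∀ {m n} → n < m → suc (m ∸ 1 ∸ n) ≡ m ∸ n
suc[m∸1∸n]≡m∸n {suc m} (s≤s n≤m) = sym (+-∸-assoc 1 n≤m)

infixl 7 _⧵[_]_
_⧵[_]_ : ℕ → ℕ → ℕ → ℕ
a ⧵[ n ] b = laverB n a a b

laverB-zero : ∀ n k y → laverB n k 0 y ≡ y
laverB-zero n zero    y = refl
laverB-zero n (suc k) y = refl

laverB-row : ∀ n k x y → laverB n (suc k) (suc x) y ≡ fold x (λ v → laverB n k v x) (2 ^ n ∸ 1 ∸ y)
-- The row function of laverB is local to its where-block; abstracting the index lets
-- unification identify it with the r of fold-unique.
laverB-row n k x y with 2 ^ n ∸ 1 ∸ y | fold-unique {g = λ v → laverB n k v x} _ (λ _ → refl)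
... | d | row≡fold = row≡fold d

laverB-≤    : ∀ n k {a x} → a ≤ x → laverB n k a x ≤ x
laverB-pred : ∀ n k a y → laverB n (suc k) (suc a) y ≤ a

laverB-≤ n zero    _                = ≤-refl
laverB-≤ n (suc k) {zero}  _        = ≤-refl
laverB-≤ n (suc k) {suc a} {x} 1+a≤x = ≤-trans (laverB-pred n k a x) (<⇒≤ 1+a≤x)

laverB-pred n k a y rewrite laverB-row n k a y = fold-≤ (λ v → laverB-≤ n k) ≤-refl (2 ^ n ∸ 1 ∸ y)

laverB-fuel : ∀ n {k k' a} b → a ≤ k → a ≤ k' → laverB n k a b ≡ laverB n k' a b
laverB-fuel n {k} {k'} {zero} b _ _ = trans (laverB-zero n k b) (sym (laverB-zero n k' b))
laverB-fuel n {suc k} {suc k'} {suc x} b (s≤s x≤k) (s≤s x≤k') = begin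
  laverB n (suc k) (suc x) b                      ≡⟨ laverB-row n k x b ⟩
  fold x (λ v → laverB n k v x) (2 ^ n ∸ 1 ∸ b)
    ≡⟨ fold-cong-≤ (λ v → laverB-≤ n k) same-row ≤-refl (2 ^ n ∸ 1 ∸ b) ⟩
  fold x (λ v → laverB n k' v x) (2 ^ n ∸ 1 ∸ b)  ≡⟨ laverB-row n k' x b ⟨
  laverB n (suc k') (suc x) b                     ∎
  where
  open ≡-Reasoning
  same-row : ∀ v → v ≤ x → laverB n k v x ≡ laverB n k' v x
  same-row v v≤x = laverB-fuel n x (≤-trans v≤x x≤k) (≤-trans v≤x x≤k')

⧵[]-≤ : ∀ n {a x} → a ≤ x → a ⧵[ n ] x ≤ x
⧵[]-≤ n {a} = laverB-≤ n a

⧵[]-pred : ∀ n a y → suc a ⧵[ n ] y ≤ a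
⧵[]-pred n a = laverB-pred n a a

orbit-⧵[]-≤ : ∀ n x j → orbit (_⧵[ n ] x) j ≤ x
orbit-⧵[]-≤ n x = fold-≤ (λ v → ⧵[]-≤ n) z≤n

⧵[]-row : ∀ n x {b} → b < 2 ^ n → suc x ⧵[ n ] b ≡ orbit (_⧵[ n ] x) (2 ^ n ∸ b)
⧵[]-row n x {b} b<2ⁿ = begin
  laverB n (suc x) (suc x) b                     ≡⟨ laverB-row n x x b ⟩
  fold x (λ v → laverB n x v x) (2 ^ n ∸ 1 ∸ b)
    ≡⟨ fold-cong-≤ (λ v → laverB-≤ n x) fuel ≤-refl (2 ^ n ∸ 1 ∸ b) ⟩
  fold x (_⧵[ n ] x) (2 ^ n ∸ 1 ∸ b)             ≡⟨ fold-suc (_⧵[ n ] x) 0 (2 ^ n ∸ 1 ∸ b) ⟩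
  orbit (_⧵[ n ] x) (suc (2 ^ n ∸ 1 ∸ b))        ≡⟨ cong (orbit (_⧵[ n ] x)) (suc[m∸1∸n]≡m∸n b<2ⁿ) ⟩
  orbit (_⧵[ n ] x) (2 ^ n ∸ b)                  ∎
  where
  open ≡-Reasoning
  fuel : ∀ v → v ≤ x → laverB n x v x ≡ v ⧵[ n ] x
  fuel v v≤x = laverB-fuel n x v≤x ≤-refl

module _ (n : ℕ) {y : ℕ} (1+y≡2ⁿ : suc y ≡ 2 ^ n) where

  ⧵[]-top : ∀ w → suc w ⧵[ n ] y ≡ w
  ⧵[]-top w = begin
    suc w ⧵[ n ] y                ≡⟨ ⧵[]-row n w (subst (y <_) 1+y≡2ⁿ ≤-refl) ⟩
    orbit (_⧵[ n ] w) (2 ^ n ∸ y) ≡⟨ cong (λ m → orbit (_⧵[ n ] w) (m ∸ y)) 1+y≡2ⁿ ⟨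
    orbit (_⧵[ n ] w) (suc y ∸ y) ≡⟨ cong (orbit (_⧵[ n ] w)) (m+n∸n≡m 1 y) ⟩
    w                             ∎
    where open ≡-Reasoning

  orbit-top : ∀ j → j ≤ y → orbit (_⧵[ n ] y) (suc j) + j ≡ y
  orbit-top zero    _      = +-identityʳ y
  orbit-top (suc j) 1+j≤y with orbit (_⧵[ n ] y) (suc j) in eq | orbit-top j (<⇒≤ 1+j≤y)
  ... | zero  | j≡y = contradiction j≡y (<⇒≢ 1+j≤y)
  ... | suc w | eqy = begin
    suc w ⧵[ n ] y + suc j ≡⟨ cong (_+ suc j) (⧵[]-top w) ⟩
    w + suc j              ≡⟨ +-suc w j ⟩
    suc w + j              ≡⟨ eqy ⟩
    y                      ∎
    where open ≡-Reasoning

  ⧵[]-cycle : ∀ {r} → r < 2 ^ n → orbit (_⧵[ n ] y) (2 ^ n ∸ r) ≡ r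
  ⧵[]-cycle {r} r<2ⁿ = +-cancelʳ-≡ _ _ r (begin
    orbit (_⧵[ n ] y) (2 ^ n ∸ r) + (y ∸ r)    ≡⟨ cong (λ m → orbit (_⧵[ n ] y) (m ∸ r) + (y ∸ r)) 1+y≡2ⁿ ⟨
    orbit (_⧵[ n ] y) (suc y ∸ r) + (y ∸ r)    ≡⟨ cong (λ m → orbit (_⧵[ n ] y) m + (y ∸ r)) (+-∸-assoc 1 r≤y) ⟩
    orbit (_⧵[ n ] y) (suc (y ∸ r)) + (y ∸ r)  ≡⟨ orbit-top (y ∸ r) (m∸n≤m y r) ⟩
    y                                          ≡⟨ m+[n∸m]≡n r≤y ⟨
    r + (y ∸ r)                                ∎)
    where
    open ≡-Reasoning
    r≤y : r ≤ y
    r≤y = s≤s⁻¹ (subst (r <_) (sym 1+y≡2ⁿ) r<2ⁿ)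

[1+m]%n≡[1+m%n]%n : ∀ m n .{{_ : NonZero n}} → suc m % n ≡ suc (m % n) % n
[1+m]%n≡[1+m%n]%n m n = begin
  suc m % n                     ≡⟨ cong (λ k → suc k % n) (m≡m%n+[m/n]*n m n) ⟩
  (suc (m % n) + m / n * n) % n ≡⟨ [m+kn]%n≡m%n (suc (m % n)) (m / n) n ⟩
  suc (m % n) % n               ∎
  where open ≡-Reasoning

orbit-2n∸ : ∀ g {n} .{{_ : NonZero n}} → orbit g n ≡ 0 → ∀ {b} → b < 2 * n
          → orbit g (2 * n ∸ b) ≡ orbit g (n ∸ b % n)
orbit-2n∸ g {n} gn≡0 {b} b<2n with b <? n
... | yes b<n = begin
  orbit g (2 * n ∸ b)  ≡⟨ cong (λ m → orbit g (n + m ∸ b)) (+-identityʳ n) ⟩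
  orbit g (n + n ∸ b)  ≡⟨ cong (orbit g) (+-∸-comm n (<⇒≤ b<n)) ⟩
  orbit g (n ∸ b + n)  ≡⟨ orbit-+ g gn≡0 (n ∸ b) ⟩
  orbit g (n ∸ b)      ≡⟨ cong (λ r → orbit g (n ∸ r)) (m<n⇒m%n≡m b<n) ⟨
  orbit g (n ∸ b % n)  ∎
  where open ≡-Reasoning
... | no b≮n = begin
  orbit g (2 * n ∸ b)              ≡⟨ cong (λ m → orbit g (n + m ∸ b)) (+-identityʳ n) ⟩
  orbit g (n + n ∸ b)              ≡⟨ cong (λ m → orbit g (n + n ∸ m)) (m+[n∸m]≡n n≤b) ⟨
  orbit g (n + n ∸ (n + (b ∸ n)))  ≡⟨ cong (orbit g) ([m+n]∸[m+o]≡n∸o n n (b ∸ n)) ⟩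
  orbit g (n ∸ (b ∸ n))            ≡⟨ cong (λ r → orbit g (n ∸ r)) b∸n≡b%n ⟩
  orbit g (n ∸ b % n)              ∎
  where
  open ≡-Reasoning
  n≤b : n ≤ b
  n≤b = ≮⇒≥ b≮n
  b∸n≡b%n : b ∸ n ≡ b % n
  b∸n≡b%n = trans (sym (m<n⇒m%n≡m (m<n+o⇒m∸n<o b n (subst (b <_) (cong (n +_) (+-identityʳ n)) b<2n))))
                  (m≤n⇒[n∸m]%m≡n%m n≤b)

-- By ⧵[]-row this says (x + 1) ⧵[ n ] 0 ≡ 0: every row of B_n has period dividing 2^n.
Periodic : ℕ → Set
Periodic n = ∀ {x} → x < 2 ^ n → orbit (_⧵[ n ] x) (2 ^ n) ≡ 0

module _ (n : ℕ) where
  private instance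
    2ⁿ≢0 : NonZero (2 ^ n)
    2ⁿ≢0 = m^n≢0 2 n

  orbit-% : ∀ {x} → (∀ {v} → v ≤ x → (v ⧵[ suc n ] x) % 2 ^ n ≡ (v % 2 ^ n) ⧵[ n ] (x % 2 ^ n))
          → ∀ j → orbit (_⧵[ suc n ] x) j % 2 ^ n ≡ orbit (_⧵[ n ] (x % 2 ^ n)) j
  orbit-% {x} hom j =
    trans (fold-map {π = _% 2 ^ n} (λ v → ⧵[]-≤ (suc n)) (λ v → hom) z≤n j)
          (cong (λ z → fold z (_⧵[ n ] (x % 2 ^ n)) j) (0%n≡0 (2 ^ n)))

  ⧵[]-% : Periodic n → ∀ a {b} → a < 2 ^ suc n → b < 2 ^ suc n
        → (a ⧵[ suc n ] b) % 2 ^ n ≡ (a % 2 ^ n) ⧵[ n ] (b % 2 ^ n)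
  ⧵[]-% periodic = <-rec _ hom
    where
    M : ℕ
    M = 2 ^ n
    Hom : ℕ → Set
    Hom a = ∀ {b} → a < 2 * M → b < 2 * M → (a ⧵[ suc n ] b) % M ≡ (a % M) ⧵[ n ] (b % M)
    hom : ∀ a → (∀ {v} → v < a → Hom v) → Hom a
    hom zero    _  {b} _ _ = cong (_⧵[ n ] (b % M)) (sym (0%n≡0 M))
    hom (suc x) ih {b} 1+x<2M b<2M = begin
      (suc x ⧵[ suc n ] b) % M               ≡⟨ cong (_% M) (⧵[]-row (suc n) x b<2M) ⟩
      orbit (_⧵[ suc n ] x) (2 * M ∸ b) % M
        ≡⟨ orbit-% (λ v≤x → ih (s≤s v≤x) (≤-<-trans v≤x x<2M) x<2M) (2 * M ∸ b) ⟩
      orbit (_⧵[ n ] x') (2 * M ∸ b)         ≡⟨ orbit-2n∸ _ (periodic (m%n<n x M)) b<2M ⟩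
      orbit (_⧵[ n ] x') (M ∸ b % M)         ≡⟨ top-row (m≤n⇒m<n∨m≡n (m%n<n x M)) ⟩
      (suc x % M) ⧵[ n ] (b % M)             ∎
      where
      open ≡-Reasoning
      x<2M : x < 2 * M
      x<2M = <-trans (n<1+n x) 1+x<2M
      x' : ℕ
      x' = x % M
      top-row : suc x' < M ⊎ suc x' ≡ M → orbit (_⧵[ n ] x') (M ∸ b % M) ≡ (suc x % M) ⧵[ n ] (b % M)
      top-row (inj₁ 1+x'<M) = begin
        orbit (_⧵[ n ] x') (M ∸ b % M)  ≡⟨ ⧵[]-row n x' (m%n<n b M) ⟨
        suc x' ⧵[ n ] (b % M)           ≡⟨ cong (_⧵[ n ] (b % M)) (m<n⇒m%n≡m 1+x'<M) ⟨
        (suc x' % M) ⧵[ n ] (b % M)     ≡⟨ cong (_⧵[ n ] (b % M)) ([1+m]%n≡[1+m%n]%n x M) ⟨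
        (suc x % M) ⧵[ n ] (b % M)      ∎
      top-row (inj₂ 1+x'≡M) = begin
        orbit (_⧵[ n ] x') (M ∸ b % M)  ≡⟨ ⧵[]-cycle n 1+x'≡M (m%n<n b M) ⟩
        b % M                           ≡⟨⟩
        0 ⧵[ n ] (b % M)                ≡⟨ cong (_⧵[ n ] (b % M)) (trans (cong (_% M) 1+x'≡M) (n%n≡0 M)) ⟨
        (suc x' % M) ⧵[ n ] (b % M)     ≡⟨ cong (_⧵[ n ] (b % M)) ([1+m]%n≡[1+m%n]%n x M) ⟨
        (suc x % M) ⧵[ n ] (b % M)      ∎

periodic : ∀ n → Periodic n
periodic zero    {zero} _ = refl
periodic zero    {suc _} (s≤s ())
periodic (suc n) {x} x<2M =
  orbit-lift (2 ^ n) (λ v → ⧵[]-pred (suc n) v x) (λ j → ≤-<-trans (orbit-⧵[]-≤ (suc n) x j) x<2M)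
    (orbit-% n (λ v≤x → ⧵[]-% n (periodic n) _ (≤-<-trans v≤x x<2M) x<2M)) (periodic n (m%n<n x (2 ^ n)))
  where instance _ = m^n≢0 2 n

n<2^n : ∀ n → n < 2 ^ n
n<2^n zero    = z<s
n<2^n (suc n) = +-mono-≤ (m^n>0 2 n) (≤-trans (n<2^n n) (m≤m+n (2 ^ n) 0))

⧵[]-< : ∀ m {M a b} → a < M → b < M → a ⧵[ m ] b < M
⧵[]-< m {a = zero}  _   b<M = b<M
⧵[]-< m {a = suc a} {b} a<M _ = ≤-<-trans (⧵[]-pred m a b) (<-trans (n<1+n a) a<M)

⧵[]-suc : ∀ n {a b} → a < 2 ^ n → b < 2 ^ n → a ⧵[ suc n ] b ≡ a ⧵[ n ] b
⧵[]-suc n {a} {b} a<2ⁿ b<2ⁿ = begin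
  a ⧵[ suc n ] b               ≡⟨ m<n⇒m%n≡m (⧵[]-< (suc n) a<2ⁿ b<2ⁿ) ⟨
  (a ⧵[ suc n ] b) % 2 ^ n     ≡⟨ ⧵[]-% n (periodic n) a (<2ⁿ⁺¹ a<2ⁿ) (<2ⁿ⁺¹ b<2ⁿ) ⟩
  (a % 2 ^ n) ⧵[ n ] (b % 2 ^ n) ≡⟨ cong₂ _⧵[ n ]_ (m<n⇒m%n≡m a<2ⁿ) (m<n⇒m%n≡m b<2ⁿ) ⟩
  a ⧵[ n ] b                   ∎
  where
  open ≡-Reasoning
  instance _ = m^n≢0 2 n
  <2ⁿ⁺¹ : ∀ {c} → c < 2 ^ n → c < 2 ^ suc n
  <2ⁿ⁺¹ c<2ⁿ = <-≤-trans c<2ⁿ (m≤m+n (2 ^ n) _)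

⧵[]-mono : ∀ {n m a b} → n ≤ m → a < 2 ^ n → b < 2 ^ n → a ⧵[ m ] b ≡ a ⧵[ n ] b
⧵[]-mono {m = m} n≤m a<2ⁿ b<2ⁿ with m≤n⇒m<n∨m≡n n≤m
... | inj₂ refl = refl
⧵[]-mono {n} {suc m} _ a<2ⁿ b<2ⁿ | inj₁ (s≤s n≤m) =
  trans (⧵[]-suc m (<-≤-trans a<2ⁿ 2ⁿ≤2ᵐ) (<-≤-trans b<2ⁿ 2ⁿ≤2ᵐ)) (⧵[]-mono n≤m a<2ⁿ b<2ⁿ)
  where
  2ⁿ≤2ᵐ : 2 ^ n ≤ 2 ^ m
  2ⁿ≤2ᵐ = ^-monoʳ-≤ 2 n≤m

⧵-⧵[] : ∀ {n a b} → a < 2 ^ n → b < 2 ^ n → a ⧵ b ≡ a ⧵[ n ] b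
⧵-⧵[] {n} {a} {b} a<2ⁿ b<2ⁿ =
  trans (sym (⧵[]-mono (m≤m⊔n N n) (<2ᴺ (≤-trans (m≤m+n a b) (m≤m+n (a + b) 1)))
                                  (<2ᴺ (≤-trans (m≤n+m b a) (m≤m+n (a + b) 1)))))
        (⧵[]-mono (m≤n⊔m N n) a<2ⁿ b<2ⁿ)
  where
  N : ℕ
  N = a + b + 1
  <2ᴺ : ∀ {c} → c ≤ N → c < 2 ^ N
  <2ᴺ c≤N = ≤-<-trans c≤N (n<2^n N)

orbit-⧵[] : ∀ {n x} → x < 2 ^ n → ∀ j → orbit (_⧵ x) j ≡ orbit (_⧵[ n ] x) j
orbit-⧵[] {n} {x} x<2ⁿ = fold-cong-≤ (λ v → laverB-≤ _ v) (λ v v≤x → ⧵-⧵[] (≤-<-trans v≤x x<2ⁿ) x<2ⁿ) z≤n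

column-period : ∀ n {x} → x < 2 ^ n → orbit (_⧵ x) (2 ^ n) ≡ 0
column-period n x<2ⁿ = trans (orbit-⧵[] x<2ⁿ (2 ^ n)) (periodic n x<2ⁿ)

orbit-returns : ∀ x r → ∃ λ j → orbit (_⧵ x) (r + j) ≡ 0
orbit-returns x r = 2 ^ n ∸ r , trans (cong (orbit (_⧵ x)) (m+[n∸m]≡n (<⇒≤ r<2ⁿ))) (column-period n x<2ⁿ)
  where
  n : ℕ
  n = x + r
  x<2ⁿ : x < 2 ^ n
  x<2ⁿ = ≤-<-trans (m≤m+n x r) (n<2^n n)
  r<2ⁿ : r < 2 ^ n
  r<2ⁿ = ≤-<-trans (m≤n+m r x) (n<2^n n)

⧵-orbit : ∀ x b {j} → orbit (_⧵ x) (b + j) ≡ 0 → suc x ⧵ b ≡ orbit (_⧵ x) j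
⧵-orbit x b {j} returns = begin
  suc x ⧵ b                           ≡⟨ ⧵-⧵[] 1+x<2ⁿ b<2ⁿ ⟩
  suc x ⧵[ n ] b                      ≡⟨ ⧵[]-row n x b<2ⁿ ⟩
  orbit (_⧵[ n ] x) (2 ^ n ∸ b)       ≡⟨ orbit-⧵[] x<2ⁿ (2 ^ n ∸ b) ⟨
  orbit (_⧵ x) (2 ^ n ∸ b)            ≡⟨ orbit-+ (_⧵ x) returns (2 ^ n ∸ b) ⟨
  orbit (_⧵ x) (2 ^ n ∸ b + (b + j))  ≡⟨ cong (orbit (_⧵ x)) reindex ⟩
  orbit (_⧵ x) (j + 2 ^ n)            ≡⟨ orbit-+ (_⧵ x) (column-period n x<2ⁿ) j ⟩
  orbit (_⧵ x) j                      ∎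
  where
  open ≡-Reasoning
  n : ℕ
  n = suc x + b
  1+x<2ⁿ : suc x < 2 ^ n
  1+x<2ⁿ = ≤-<-trans (m≤m+n (suc x) b) (n<2^n n)
  x<2ⁿ : x < 2 ^ n
  x<2ⁿ = <-trans (n<1+n x) 1+x<2ⁿ
  b<2ⁿ : b < 2 ^ n
  b<2ⁿ = ≤-<-trans (m≤n+m b (suc x)) (n<2^n n)
  reindex : 2 ^ n ∸ b + (b + j) ≡ j + 2 ^ n
  reindex = trans (sym (+-assoc (2 ^ n ∸ b) b j)) (trans (cong (_+ j) (m∸n+n≡m (<⇒≤ b<2ⁿ))) (+-comm (2 ^ n) j))

pred[2^n]<2^n : ∀ n → pred (2 ^ n) < 2 ^ n
pred[2^n]<2^n n = subst (pred (2 ^ n) <_) (suc-pred (2 ^ n)) ≤-refl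
  where instance _ = m^n≢0 2 n

⧵-2^ : ∀ N q {r} → r < 2 ^ N → 2 ^ N ⧵ (2 ^ N * q + r) ≡ r
⧵-2^ N q {r} r<2ᴺ = begin
  2 ^ N ⧵ (M * q + r)        ≡⟨ cong (_⧵ (M * q + r)) (suc-pred M) ⟨
  suc y ⧵ (M * q + r)        ≡⟨ ⧵-orbit y (M * q + r) returns ⟩
  orbit (_⧵ y) (M ∸ r)       ≡⟨ orbit-⧵[] y<2ᴺ (M ∸ r) ⟩
  orbit (_⧵[ N ] y) (M ∸ r)  ≡⟨ ⧵[]-cycle N (suc-pred M) r<2ᴺ ⟩
  r                          ∎
  where
  open ≡-Reasoning
  instance _ = m^n≢0 2 N
  M y : ℕ
  M = 2 ^ N
  y = pred M
  y<2ᴺ : y < M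
  y<2ᴺ = pred[2^n]<2^n N
  multiple : M * q + r + (M ∸ r) ≡ suc q * M
  multiple = begin
    M * q + r + (M ∸ r)    ≡⟨ +-assoc (M * q) r (M ∸ r) ⟩
    M * q + (r + (M ∸ r))  ≡⟨ cong (M * q +_) (m+[n∸m]≡n (<⇒≤ r<2ᴺ)) ⟩
    M * q + M              ≡⟨ +-comm (M * q) M ⟩
    M + M * q              ≡⟨ cong (M +_) (*-comm M q) ⟩
    suc q * M              ∎
  returns : orbit (_⧵ y) (M * q + r + (M ∸ r)) ≡ 0
  returns = trans (cong (orbit (_⧵ y)) multiple) (orbit-* (_⧵ y) {M} (column-period N y<2ᴺ) (suc q))

⧵≡0⇒orbit≡0 : ∀ x p → suc x ⧵ p ≡ 0 → orbit (_⧵ x) p ≡ 0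
⧵≡0⇒orbit≡0 x p 1+x⧵p≡0 with orbit-returns x p
... | j , returns = begin
  orbit (_⧵ x) p        ≡⟨ orbit-+ (_⧵ x) (trans (sym (⧵-orbit x p returns)) 1+x⧵p≡0) p ⟨
  orbit (_⧵ x) (p + j)  ≡⟨ returns ⟩
  0                     ∎
  where open ≡-Reasoning

⧵-period : ∀ x p → (x + 1) ⧵ p ≡ 0 → ∀ q r → (x + 1) ⧵ (p * q + r) ≡ (x + 1) ⧵ r
⧵-period x p rewrite +-comm x 1 = suc-⧵-period
  where
  suc-⧵-period : suc x ⧵ p ≡ 0 → ∀ q r → suc x ⧵ (p * q + r) ≡ suc x ⧵ r
  suc-⧵-period 1+x⧵p≡0 q r with orbit-returns x r
  ... | j , returns = trans (⧵-orbit x (p * q + r) returns′) (sym (⧵-orbit x r returns))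
    where
    open ≡-Reasoning
    p-returns : orbit (_⧵ x) p ≡ 0
    p-returns = ⧵≡0⇒orbit≡0 x p 1+x⧵p≡0
    returns′ : orbit (_⧵ x) (p * q + r + j) ≡ 0
    returns′ = begin
      orbit (_⧵ x) (p * q + r + j)    ≡⟨ cong (orbit (_⧵ x)) (+-assoc (p * q) r j) ⟩
      orbit (_⧵ x) (p * q + (r + j))  ≡⟨ cong (λ k → orbit (_⧵ x) (k + (r + j))) (*-comm p q) ⟩
      orbit (_⧵ x) (q * p + (r + j))  ≡⟨ cong (orbit (_⧵ x)) (+-comm (q * p) (r + j)) ⟩
      orbit (_⧵ x) (r + j + q * p)    ≡⟨ orbit-+ (_⧵ x) (orbit-* (_⧵ x) p-returns q) (r + j) ⟩
      orbit (_⧵ x) (r + j)            ≡⟨ returns ⟩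
      0                               ∎

digits : ∀ p k → ∃₂ λ u v → v < 2 ^ p × k ≡ 2 ^ p * u + v
digits p k = k / 2 ^ p , k % 2 ^ p , m%n<n k (2 ^ p) , k≡2ᵖ[k/2ᵖ]+k%2ᵖ
  where
  instance _ = m^n≢0 2 p
  k≡2ᵖ[k/2ᵖ]+k%2ᵖ : k ≡ 2 ^ p * (k / 2 ^ p) + k % 2 ^ p
  k≡2ᵖ[k/2ᵖ]+k%2ᵖ = begin
    k                             ≡⟨ m≡m%n+[m/n]*n k (2 ^ p) ⟩
    k % 2 ^ p + k / 2 ^ p * 2 ^ p ≡⟨ +-comm (k % 2 ^ p) _ ⟩
    k / 2 ^ p * 2 ^ p + k % 2 ^ p ≡⟨ cong (_+ k % 2 ^ p) (*-comm (k / 2 ^ p) (2 ^ p)) ⟩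
    2 ^ p * (k / 2 ^ p) + k % 2 ^ p ∎
    where open ≡-Reasoning

record Splits (f : ℕ → ℕ) (p q : ℕ) (g : ℕ → ℕ) : Set where
  field split : ∀ u v → v < 2 ^ p → f (2 ^ p * u + v) ≡ g u + 2 ^ q * v
open Splits

Splits-refl : ∀ f q → Splits f 0 q f
Splits-refl f q .split u zero    _ = trans (cong f (trans (+-identityʳ _) (+-identityʳ u)))
                                           (sym (trans (cong (f u +_) (*-zeroʳ (2 ^ q))) (+-identityʳ (f u))))
Splits-refl f q .split u (suc v) (s≤s ())

Splits-trans : ∀ {f g h p p' q} → Splits f p q g → Splits g p' (q + p) h → Splits f (p + p') q h
Splits-trans {f} {g} {h} {p} {p'} {q} f≈g g≈h .split u v v<2ᵖ⁺ᵖ' with digits p v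
... | v₁ , v₀ , v₀<2ᵖ , v≡ = begin
  f (2 ^ (p + p') * u + v)                       ≡⟨ cong f regroup ⟩
  f (2 ^ p * (2 ^ p' * u + v₁) + v₀)             ≡⟨ split f≈g (2 ^ p' * u + v₁) v₀ v₀<2ᵖ ⟩
  g (2 ^ p' * u + v₁) + 2 ^ q * v₀               ≡⟨ cong (_+ 2 ^ q * v₀) (split g≈h u v₁ v₁<2ᵖ') ⟩
  h u + 2 ^ (q + p) * v₁ + 2 ^ q * v₀            ≡⟨ join ⟩
  h u + 2 ^ q * v                                ∎
  where
  open ≡-Reasoning
  v₁<2ᵖ' : v₁ < 2 ^ p'
  v₁<2ᵖ' = *-cancelˡ-< (2 ^ p) v₁ (2 ^ p')
    (≤-<-trans (m≤m+n (2 ^ p * v₁) v₀) (subst₂ _<_ v≡ (^-distribˡ-+-* 2 p p') v<2ᵖ⁺ᵖ'))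
  regroup : 2 ^ (p + p') * u + v ≡ 2 ^ p * (2 ^ p' * u + v₁) + v₀
  regroup = begin
    2 ^ (p + p') * u + v                ≡⟨ cong₂ (λ a b → a * u + b) (^-distribˡ-+-* 2 p p') v≡ ⟩
    2 ^ p * 2 ^ p' * u + (2 ^ p * v₁ + v₀) ≡⟨ ring (2 ^ p) (2 ^ p') u v₁ v₀ ⟩
    2 ^ p * (2 ^ p' * u + v₁) + v₀     ∎
    where
    ring : ∀ P P' u a b → P * P' * u + (P * a + b) ≡ P * (P' * u + a) + b
    ring = solve-∀
  join : h u + 2 ^ (q + p) * v₁ + 2 ^ q * v₀ ≡ h u + 2 ^ q * v
  join = begin
    h u + 2 ^ (q + p) * v₁ + 2 ^ q * v₀      ≡⟨ cong (λ a → h u + a * v₁ + 2 ^ q * v₀) (^-distribˡ-+-* 2 q p) ⟩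
    h u + 2 ^ q * 2 ^ p * v₁ + 2 ^ q * v₀    ≡⟨ ring (h u) (2 ^ q) (2 ^ p) v₁ v₀ ⟩
    h u + 2 ^ q * (2 ^ p * v₁ + v₀)          ≡⟨ cong (λ a → h u + 2 ^ q * a) v≡ ⟨
    h u + 2 ^ q * v                          ∎
    where
    ring : ∀ c Q P a b → c + Q * P * a + Q * b ≡ c + Q * (P * a + b)
    ring = solve-∀

Splits-FirstZero : ∀ {f g p q z} → Splits f p q g → FirstZero g z → FirstZero f (2 ^ p * z)
Splits-FirstZero {f} {g} {p} {q} {z} f≈g (0<z , gz≡0 , minimal) = 0<2ᵖz , f[2ᵖz]≡0 , no-earlier
  where
  0<2ᵖz : 0 < 2 ^ p * z
  0<2ᵖz = *-mono-< (m^n>0 2 p) 0<z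
  f[2ᵖz]≡0 : f (2 ^ p * z) ≡ 0
  f[2ᵖz]≡0 = begin
    f (2 ^ p * z)           ≡⟨ cong f (+-identityʳ _) ⟨
    f (2 ^ p * z + 0)       ≡⟨ split f≈g z 0 (m^n>0 2 p) ⟩
    g z + 2 ^ q * 0         ≡⟨ cong₂ _+_ gz≡0 (*-zeroʳ (2 ^ q)) ⟩
    0                       ∎
    where open ≡-Reasoning
  no-earlier : ∀ k → 0 < k → k < 2 ^ p * z → f k ≢ 0
  no-earlier k 0<k k<2ᵖz fk≡0 with digits p k
  ... | u , v , v<2ᵖ , k≡ = minimal u 0<u u<z gu≡0
    where
    split≡0 : g u + 2 ^ q * v ≡ 0
    split≡0 = trans (sym (split f≈g u v v<2ᵖ)) (trans (cong f (sym k≡)) fk≡0)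
    gu≡0 : g u ≡ 0
    gu≡0 = m+n≡0⇒m≡0 (g u) split≡0
    v≡0 : v ≡ 0
    v≡0 = m*n≡0⇒m≡0 v (2 ^ q) (trans (*-comm v (2 ^ q)) (m+n≡0⇒n≡0 (g u) split≡0))
      where instance _ = m^n≢0 2 q
    k≡2ᵖu : k ≡ 2 ^ p * u
    k≡2ᵖu = trans k≡ (trans (cong (2 ^ p * u +_) v≡0) (+-identityʳ _))
    0<u : 0 < u
    0<u = n≢0⇒n>0 λ u≡0 → <⇒≢ 0<k (sym (trans k≡2ᵖu (trans (cong (2 ^ p *_) u≡0) (*-zeroʳ (2 ^ p)))))
    u<z : u < z
    u<z = *-cancelˡ-< (2 ^ p) u z (subst (_< 2 ^ p * z) k≡2ᵖu k<2ᵖz)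

digits-< : ∀ p q {u v} → u < 2 ^ p → v < 2 ^ q → 2 ^ q * u + v < 2 ^ (p + q)
digits-< p q {u} {v} u<2ᵖ v<2^q = begin-strict
  2 ^ q * u + v        <⟨ +-monoʳ-< (2 ^ q * u) v<2^q ⟩
  2 ^ q * u + 2 ^ q    ≡⟨ +-comm (2 ^ q * u) (2 ^ q) ⟩
  2 ^ q + 2 ^ q * u    ≡⟨ *-suc (2 ^ q) u ⟨
  2 ^ q * suc u        ≤⟨ *-monoʳ-≤ (2 ^ q) u<2ᵖ ⟩
  2 ^ q * 2 ^ p        ≡⟨ *-comm (2 ^ q) (2 ^ p) ⟩
  2 ^ p * 2 ^ q        ≡⟨ ^-distribˡ-+-* 2 p q ⟨
  2 ^ (p + q)          ∎
  where open ≤-Reasoning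

-- With y = 2^n − 1 the element compared with a in Hyp is 2^(l+n) − 1, and the row of its
-- successor is reduction mod 2^(l+n) (⧵-2^).
Hyp⇒Splits : ∀ {L} → Hyp L → ∀ {a x m n l} → a < L → a ≡ x + 2 ^ (m * n) * (2 ^ n ∸ 1) → IsPow2 n
           → 2 ^ ((m + 1) * n) ∣ x → PeriodLength (x + 1) (2 ^ l) → l ≤ n
           → Splits ((a + 1) ⧵_) n (m * n) ((x + 1) ⧵_)
Hyp⇒Splits hyp {a} {x} {m} {n} {l} a<L a≡ n-pow2 2^[m+1]n∣x period l≤n .split w y y<2ⁿ with digits l w
... | w₁ , w₀ , w₀<2ˡ , w≡ = begin
  (a + 1) ⧵ (2 ^ n * w + y)            ≡⟨ row-law (2 ^ n * w + y) w₀ y y<2ⁿ top-row ⟩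
  (x + 1) ⧵ w₀ + 2 ^ (m * n) * y       ≡⟨ cong (_+ 2 ^ (m * n) * y) x+1-row ⟨
  (x + 1) ⧵ w + 2 ^ (m * n) * y        ∎
  where
  open ≡-Reasoning
  row-law : ∀ i w y → y < 2 ^ n → (2 ^ (l + n) ∸ 2 ^ n + (2 ^ n ∸ 1) + 1) ⧵ i ≡ 2 ^ n * w + y
          → (a + 1) ⧵ i ≡ (x + 1) ⧵ w + 2 ^ (m * n) * y
  row-law = proj₂ (hyp a x (2 ^ n ∸ 1) m n l a<L a≡ n-pow2 (pred[2^n]<2^n n) 2^[m+1]n∣x period l≤n)
  x+1-row : (x + 1) ⧵ w ≡ (x + 1) ⧵ w₀
  x+1-row = trans (cong ((x + 1) ⧵_) w≡) (⧵-period x (2 ^ l) (proj₁ (proj₂ period)) w₁ w₀)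
  i≡ : 2 ^ n * w + y ≡ 2 ^ (l + n) * w₁ + (2 ^ n * w₀ + y)
  i≡ = begin
    2 ^ n * w + y                            ≡⟨ cong (λ k → 2 ^ n * k + y) w≡ ⟩
    2 ^ n * (2 ^ l * w₁ + w₀) + y            ≡⟨ ring (2 ^ n) (2 ^ l) w₁ w₀ y ⟩
    2 ^ l * 2 ^ n * w₁ + (2 ^ n * w₀ + y)    ≡⟨ cong (λ k → k * w₁ + (2 ^ n * w₀ + y)) (^-distribˡ-+-* 2 l n) ⟨
    2 ^ (l + n) * w₁ + (2 ^ n * w₀ + y)      ∎
    where
    ring : ∀ N L u v y → N * (L * u + v) + y ≡ L * N * u + (N * v + y)
    ring = solve-∀
  top-row : (2 ^ (l + n) ∸ 2 ^ n + (2 ^ n ∸ 1) + 1) ⧵ (2 ^ n * w + y) ≡ 2 ^ n * w₀ + y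
  top-row = begin
    (2 ^ (l + n) ∸ 2 ^ n + (2 ^ n ∸ 1) + 1) ⧵ (2 ^ n * w + y)  ≡⟨ cong₂ _⧵_ top≡2ˡ⁺ⁿ i≡ ⟩
    2 ^ (l + n) ⧵ (2 ^ (l + n) * w₁ + (2 ^ n * w₀ + y))        ≡⟨ ⧵-2^ (l + n) w₁ (digits-< l n w₀<2ˡ y<2ⁿ) ⟩
    2 ^ n * w₀ + y                                             ∎
    where
    top≡2ˡ⁺ⁿ : 2 ^ (l + n) ∸ 2 ^ n + (2 ^ n ∸ 1) + 1 ≡ 2 ^ (l + n)
    top≡2ˡ⁺ⁿ = begin
      2 ^ (l + n) ∸ 2 ^ n + (2 ^ n ∸ 1) + 1    ≡⟨ +-assoc (2 ^ (l + n) ∸ 2 ^ n) (2 ^ n ∸ 1) 1 ⟩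
      2 ^ (l + n) ∸ 2 ^ n + (2 ^ n ∸ 1 + 1)    ≡⟨ cong (2 ^ (l + n) ∸ 2 ^ n +_) (m∸n+n≡m (m^n>0 2 n)) ⟩
      2 ^ (l + n) ∸ 2 ^ n + 2 ^ n              ≡⟨ m∸n+n≡m (^-monoʳ-≤ 2 (m≤n+m n l)) ⟩
      2 ^ (l + n)                              ∎

2^-∣ : ∀ {a b} → a ≤ b → 2 ^ a ∣ 2 ^ b
2^-∣ {a} {b} a≤b = divides (2 ^ (b ∸ a)) (begin
  2 ^ b                ≡⟨ cong (2 ^_) (m∸n+n≡m a≤b) ⟨
  2 ^ (b ∸ a + a)      ≡⟨ ^-distribˡ-+-* 2 (b ∸ a) a ⟩
  2 ^ (b ∸ a) * 2 ^ a  ∎)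
  where open ≡-Reasoning

∣∧<⇒+≤ : ∀ {d a n} → d ∣ a → d ∣ n → a < n → d + a ≤ n
∣∧<⇒+≤ {d} (divides α refl) (divides β refl) αd<βd = *-monoˡ-≤ d (*-cancelʳ-< d α β αd<βd)

a+2ᵗ≡b+2ᵗ⁺ⁿ⇒a≡b+2ᵗ[2ⁿ∸1] : ∀ {a b t n} → a + 2 ^ t ≡ b + 2 ^ (t + n) → a ≡ b + 2 ^ t * (2 ^ n ∸ 1)
a+2ᵗ≡b+2ᵗ⁺ⁿ⇒a≡b+2ᵗ[2ⁿ∸1] {a} {b} {t} {n} a+2ᵗ≡ = +-cancelʳ-≡ (2 ^ t) a _ (begin
  a + 2 ^ t                         ≡⟨ a+2ᵗ≡ ⟩
  b + 2 ^ (t + n)                   ≡⟨ cong (b +_) (^-distribˡ-+-* 2 t n) ⟩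
  b + 2 ^ t * 2 ^ n                 ≡⟨ cong (λ k → b + 2 ^ t * k) (suc-pred (2 ^ n)) ⟨
  b + 2 ^ t * suc (2 ^ n ∸ 1)       ≡⟨ ring b (2 ^ t) (2 ^ n ∸ 1) ⟩
  b + 2 ^ t * (2 ^ n ∸ 1) + 2 ^ t   ∎)
  where
  open ≡-Reasoning
  instance _ = m^n≢0 2 n
  ring : ∀ a b c → a + b * (1 + c) ≡ a + b * c + b
  ring = solve-∀

module Descent {L} (hyp : Hyp L) {x s l k} (x+2ˢ∸1<L : x + 2 ^ s ∸ 1 < L) (2ˢ∣x : 2 ^ s ∣ x)
  (period : PeriodLength (x + 1) (2 ^ l)) (2ᵏ∣s : 2 ^ k ∣ s) (l≤2ᵏ : l ≤ 2 ^ k) where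

  Stage : ℕ → ℕ → Set
  Stage t d = ∀ X → X + 2 ^ t ≡ x + 2 ^ s → Splits ((X + 1) ⧵_) d t ((x + 1) ⧵_)

  Stage-period : ∀ {t d X} → Stage t d → X + 2 ^ t ≡ x + 2 ^ s → PeriodLength (X + 1) (2 ^ (l + d))
  Stage-period {t} {d} {X} stage X+2ᵗ≡ =
    subst (PeriodLength (X + 1)) 2ᵈ2ˡ≡2ˡ⁺ᵈ (Splits-FirstZero (stage X X+2ᵗ≡) period)
    where
    2ᵈ2ˡ≡2ˡ⁺ᵈ : 2 ^ d * 2 ^ l ≡ 2 ^ (l + d)
    2ᵈ2ˡ≡2ˡ⁺ᵈ = trans (*-comm (2 ^ d) (2 ^ l)) (sym (^-distribˡ-+-* 2 l d))

  stage-base : Stage s 0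
  stage-base X X+2ˢ≡ rewrite +-cancelʳ-≡ (2 ^ s) X x X+2ˢ≡ = Splits-refl ((x + 1) ⧵_) s

  stage-step : ∀ {t d} n → 2 ^ n ∣ t → t + 2 ^ n + d ≡ s → l + d ≤ 2 ^ n
             → Stage (t + 2 ^ n) d → Stage t (2 ^ n + d)
  stage-step {d = d} n (divides m refl) t+N+d≡s l+d≤N next X X+2ᵗ≡ = Splits-trans this (next X' X'+2ᵗ⁺ᴺ≡)
    where
    N t S X' : ℕ
    N = 2 ^ n
    t = m * N
    S = x + 2 ^ s
    X' = S ∸ 2 ^ (t + N)
    t+N≤s : t + N ≤ s
    t+N≤s = subst (t + N ≤_) t+N+d≡s (m≤m+n (t + N) d)
    X'+2ᵗ⁺ᴺ≡ : X' + 2 ^ (t + N) ≡ S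
    X'+2ᵗ⁺ᴺ≡ = m∸n+n≡m (≤-trans (^-monoʳ-≤ 2 t+N≤s) (m≤n+m (2 ^ s) x))
    X≡ : X ≡ X' + 2 ^ t * (2 ^ N ∸ 1)
    X≡ = a+2ᵗ≡b+2ᵗ⁺ⁿ⇒a≡b+2ᵗ[2ⁿ∸1] {X} {X'} {t} {N} (trans X+2ᵗ≡ (sym X'+2ᵗ⁺ᴺ≡))
    X<L : X < L
    X<L = ≤-<-trans (m+n≤o⇒m≤o∸n X (subst (X + 1 ≤_) X+2ᵗ≡ (+-monoʳ-≤ X (m^n>0 2 t)))) x+2ˢ∸1<L
    2^[m+1]N∣X' : 2 ^ ((m + 1) * N) ∣ X'
    2^[m+1]N∣X' = subst (λ e → 2 ^ e ∣ X') (sym [m+1]N≡t+N)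
      (∣m+n∣m⇒∣n (subst (2 ^ (t + N) ∣_) (trans (sym X'+2ᵗ⁺ᴺ≡) (+-comm X' _)) 2ᵗ⁺ᴺ∣S) ∣-refl)
      where
      [m+1]N≡t+N : (m + 1) * N ≡ t + N
      [m+1]N≡t+N = trans (*-distribʳ-+ N m 1) (cong (t +_) (*-identityˡ N))
      2ᵗ⁺ᴺ∣S : 2 ^ (t + N) ∣ S
      2ᵗ⁺ᴺ∣S = ∣m∣n⇒∣m+n (∣-trans (2^-∣ t+N≤s) 2ˢ∣x) (2^-∣ t+N≤s)
    this : Splits ((X + 1) ⧵_) N t ((X' + 1) ⧵_)
    this = Hyp⇒Splits hyp {m = m} X<L X≡ (n , refl) 2^[m+1]N∣X' (Stage-period next X'+2ᵗ⁺ᴺ≡) l+d≤N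

  descend : ∀ j {t d} → t + d ≡ s → 2 ^ (j + k) ∣ t → d < 2 ^ (j + k) → 2 ^ k ∣ d → Stage t d
  descend zero {t} {zero} t+0≡s _ _ _ = subst (λ t → Stage t 0) (trans (sym t+0≡s) (+-identityʳ t)) stage-base
  descend zero {d = suc d} _ _ d<2ᵏ 2ᵏ∣d = contradiction (∣⇒≤ 2ᵏ∣d) (<⇒≱ d<2ᵏ)
  descend (suc j) {t} {d} t+d≡s 2N∣t d<2N 2ᵏ∣d with 2 ^ (j + k) ≤? d
  ... | no  d≱N = descend j t+d≡s (∣-trans (n∣m*n 2) 2N∣t) (≰⇒> d≱N) 2ᵏ∣d
  ... | yes N≤d = subst (Stage t) (m+[n∸m]≡n N≤d)
        (stage-step (j + k) N∣t t+N+d'≡s (≤-trans (+-monoˡ-≤ d' l≤2ᵏ) 2ᵏ+d'≤N)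
          (descend j t+N+d'≡s (∣m∣n⇒∣m+n N∣t ∣-refl) d'<N 2ᵏ∣d'))
    where
    N d' : ℕ
    N = 2 ^ (j + k)
    d' = d ∸ N
    N∣t : N ∣ t
    N∣t = ∣-trans (n∣m*n 2) 2N∣t
    t+N+d'≡s : t + N + d' ≡ s
    t+N+d'≡s = trans (+-assoc t N d') (trans (cong (t +_) (m+[n∸m]≡n N≤d)) t+d≡s)
    d'<N : d' < N
    d'<N = m<n+o⇒m∸n<o d N (subst (d <_) (cong (N +_) (+-identityʳ N)) d<2N)
      where instance _ = m^n≢0 2 (j + k)
    2ᵏ∣N : 2 ^ k ∣ N
    2ᵏ∣N = 2^-∣ (m≤n+m k j)
    2ᵏ∣d' : 2 ^ k ∣ d'
    2ᵏ∣d' = ∣m+n∣m⇒∣n (subst (2 ^ k ∣_) (sym (m+[n∸m]≡n N≤d)) 2ᵏ∣d) 2ᵏ∣N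
    2ᵏ+d'≤N : 2 ^ k + d' ≤ N
    2ᵏ+d'≤N = ∣∧<⇒+≤ 2ᵏ∣d' 2ᵏ∣N d'<N

lemma4p4 : ∀ L → Hyp L → ∀ x s l → x + 2 ^ s ∸ 1 < L → 2 ^ s ∣ x
    → PeriodLength (x + 1) (2 ^ l) → (∃ λ k → (2 ^ k ∣ s) × (l ≤ 2 ^ k))
    → (∀ i i' → i' < 2 ^ s → (x + 2 ^ s) ⧵ (2 ^ s * i + i') ≡ (x + 1) ⧵ i + i')
    × PeriodLength (x + 2 ^ s) (2 ^ (l + s))
lemma4p4 L hyp x s l x+2ˢ∸1<L 2ˢ∣x period (k , 2ᵏ∣s , l≤2ᵏ) =
  row , subst (λ a → PeriodLength a (2 ^ (l + s))) X+1≡ (Stage-period whole X+1≡)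
  where
  open Descent hyp {k = k} x+2ˢ∸1<L 2ˢ∣x period 2ᵏ∣s l≤2ᵏ
  X : ℕ
  X = x + 2 ^ s ∸ 1
  X+1≡ : X + 1 ≡ x + 2 ^ s
  X+1≡ = m∸n+n≡m (≤-trans (m^n>0 2 s) (m≤n+m (2 ^ s) x))
  whole : Stage 0 s
  whole = descend s refl ((2 ^ (s + k)) ∣0) (<-≤-trans (n<2^n s) (^-monoʳ-≤ 2 (m≤m+n s k))) 2ᵏ∣s
  row : ∀ i i' → i' < 2 ^ s → (x + 2 ^ s) ⧵ (2 ^ s * i + i') ≡ (x + 1) ⧵ i + i'
  row i i' i'<2ˢ = begin
    (x + 2 ^ s) ⧵ (2 ^ s * i + i')  ≡⟨ cong (_⧵ (2 ^ s * i + i')) X+1≡ ⟨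
    (X + 1) ⧵ (2 ^ s * i + i')      ≡⟨ split (whole X X+1≡) i i' i'<2ˢ ⟩
    (x + 1) ⧵ i + 1 * i'            ≡⟨ cong ((x + 1) ⧵ i +_) (*-identityˡ i') ⟩
    (x + 1) ⧵ i + i'                ∎
    where open ≡-Reasoning
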